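{- Let $(X,\preceq)$ be a finite semilattice with rank function, maximum rank $m$ and fibers $X_i$, satisfying conditions (I)–(IV) described in the context. Let $r,s,t$ be integers with $0\le r\le s<t\le m$ and $s,t$ positive, and let $Y\subseteq X_m$ be a $t$-design; for $j\le t$ let $\lambda_j$ denote the index of $Y$ as a $j$-design. Define $$d_r=\max\,\bigl|\{z\in Y:\ x\preceq z,\ |z\wedge y|\ge s\}\bigr|,$$ the maximum taken over all $x\in X_s$ and $y\in Y$ with $|x\wedge y|=r$. Then: (1) if $2s-t\le r\le s-1$, then $d_r\le \mu(r,s)\lambda_{2s-r}$; (2) if $r\le 2s-t$, then $d_r\le \mu(r,s)\lambda_t$.
   Context: A finite partially ordered set $(X,\preceq)$ is a semilattice if any two elements $x,y$ have a unique greatest lower bound $x\wedge y$; its least element is $0$. It has a rank function $|\cdot|:X\to\mathbb{N}\cup\{0\}$ such that $|x|+1$ is the number of elements in a maximal chain from $0$ to $x$ (ends included). Let $m$ be the maximum rank and $X_i=\{x\in X:|x|=i\}$. Standing conditions: (I) for $y\in X_m$, $z\in X_r$, the number of $u\in X_s$ with $z\preceq u\preceq y$ is a constant $\mu(r,s)$; (II) for $u\in X_s$, the number of $z\in X_r$ with $z\preceq u$ is a constant $\nu(r,s)$; (III) for every $0\le r\le m$ and $a\in X_r$, the number of $z\in X_m$ with $a\preceq z$ is a constant $\theta(r)$; (IV) for $x\in X_i$, $y\in X_j$ with $x\wedge y\in X_k$ and $i+j-k\le m$, if $x,y$ have a common upper bound then their unique least upper bound lies in $X_{i+j-k}$. For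 a positive integer $t\le m$, a non-empty set $Y\subseteq X_m$ is a $t$-design with index $\lambda_t$ if for every $z\in X_t$ the set $\{x\in Y: z\preceq x\}$ has exactly $\lambda_t$ elements. A $t$-design is also a $j$-design for every $j\le t$ (with index $\lambda_j=\lambda_t\theta(j)/\theta(t)$). -}

module Defs where

open import Level using (0ℓ)
open import Data.Nat using (ℕ; zero; suc; _+_; _∸_; _≤_; _⊔_; _≤?_)
open import Data.Nat.Properties using (_≟_)
open import Data.Fin using (Fin)
open import Data.Fin.Subset using (Subset; _∈_; Nonempty)
open import Data.Fin.Subset.Properties using (_∈?_)
open import Data.List using (List; []; _∷_; length; filter; concatMap; foldr)
open import Data.List using () renaming (allFin to allFinL)
open import Data.Product using (Σ; ∃; _×_; _,_)
open import Data.Sum using (_⊎_)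
open import Relation.Nullary using (Dec; ¬_; does)
open import Relation.Nullary.Decidable using (_×-dec_)
open import Relation.Unary using (Pred)
open import Relation.Binary using (Rel; Decidable; IsPartialOrder)
open import Relation.Binary.PropositionalEquality using (_≡_; _≢_)
open import Data.Bool using (if_then_else_)

count : ∀ {N} (P : Pred (Fin N) 0ℓ) → Relation.Unary.Decidable P → ℕ
count {N} P P? = length (filter P? (allFinL N))

module _ {N : ℕ} (_≼_ : Rel (Fin N) 0ℓ) where
  Covers : Fin N → Fin N → Set
  Covers x y = x ≼ y × x ≢ y × (∀ z → x ≼ z → z ≼ y → z ≡ x ⊎ z ≡ y)

  -- SatChain a b n : a maximal (saturated) chain a = c₀ ⋖ c₁ ⋖ … ⋖ c_{n-1} = b
  -- having exactly n elements (ends included).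
  data SatChain : Fin N → Fin N → ℕ → Set where
    single : ∀ a → SatChain a a 1
    step   : ∀ {a b c n} → Covers a b → SatChain b c n → SatChain a c (suc n)

record RankedSemilattice : Set₁ where
  field
    N      : ℕ
    _≼_    : Rel (Fin N) 0ℓ
    _≼?_   : Decidable _≼_
    isPO   : IsPartialOrder _≡_ _≼_
    _∧_    : Fin N → Fin N → Fin N
    ∧-lb₁  : ∀ x y → (x ∧ y) ≼ x
    ∧-lb₂  : ∀ x y → (x ∧ y) ≼ y
    ∧-glb  : ∀ x y z → z ≼ x → z ≼ y → z ≼ (x ∧ y)
    𝟘      : Fin N
    𝟘-least : ∀ x → 𝟘 ≼ x
    rk     : Fin N → ℕ
    rk-chain : ∀ x n → SatChain _≼_ 𝟘 x n → n ≡ suc (rk x)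
    m      : ℕ
    m-attained : ∃ λ x → rk x ≡ m
    rk≤m   : ∀ x → rk x ≤ m
    μ ν    : ℕ → ℕ → ℕ
    θ      : ℕ → ℕ
  field
    condI : ∀ r s y z → rk y ≡ m → rk z ≡ r → z ≼ y →
            count (λ u → rk u ≡ s × z ≼ u × u ≼ y)
                  (λ u → (rk u ≟ s) ×-dec (z ≼? u) ×-dec (u ≼? y)) ≡ μ r s
    condII : ∀ r s u → rk u ≡ s →
             count (λ z → rk z ≡ r × z ≼ u)
                   (λ z → (rk z ≟ r) ×-dec (z ≼? u)) ≡ ν r s
    condIII : ∀ r a → r ≤ m → rk a ≡ r →
              count (λ z → rk z ≡ m × a ≼ z)
                    (λ z → (rk z ≟ m) ×-dec (a ≼? z)) ≡ θ r
    condIV : ∀ x y → rk x + rk y ∸ rk (x ∧ y) ≤ m →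
             (∃ λ w → x ≼ w × y ≼ w) →
             ∃ λ v → (x ≼ v × y ≼ v × (∀ w → x ≼ w → y ≼ w → v ≼ w))
                     × rk v ≡ rk x + rk y ∸ rk (x ∧ y)

module _ (X : RankedSemilattice) where
  open RankedSemilattice X

  IsDesign : ℕ → Subset N → ℕ → Set
  IsDesign t Y λt =
    (∀ y → y ∈ Y → rk y ≡ m) × Nonempty Y ×
    (∀ z → rk z ≡ t →
       count (λ x → x ∈ Y × z ≼ x) (λ x → (x ∈? Y) ×-dec (z ≼? x)) ≡ λt)

  cnt : ℕ → Subset N → Fin N → Fin N → ℕ
  cnt s Y x y = count (λ z → z ∈ Y × x ≼ z × s ≤ rk (z ∧ y))
                      (λ z → (z ∈? Y) ×-dec (x ≼? z) ×-dec (s ≤? rk (z ∧ y)))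

  -- d_r = max of cnt over x ∈ X_s, y ∈ Y with |x ∧ y| = r  (max of empty list = 0)
  d : ℕ → ℕ → Subset N → ℕ
  d r s Y = foldr _⊔_ 0
    (concatMap (λ x → concatMap (λ y →
        if does ((rk x ≟ s) ×-dec (y ∈? Y) ×-dec (rk (x ∧ y) ≟ r))
        then cnt s Y x y ∷ [] else [])
      (allFinL N)) (allFinL N))

-- Fix x ∈ X_s and y ∈ Y with |x ∧ y| = r, and any x′ with x ∧ y ≼ x′ ≼ x. Every z counted by d_r
-- lies above x and has |z ∧ y| ≥ s, so it lies above some u of rank s in the interval [x ∧ y, y];
-- by (I) there are μ(r,s) such u. Since x′ ∧ u = x ∧ y, condition (IV) gives x′ and u a join of
-- rank T = |x′| + s − r, and every z ∈ Y above both lies above that join: at most λ_T of them.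
-- Part (1) takes x′ = x, so T = 2s − r; part (2) takes |x′| = r + t − s, so T = t. Such x′ exists
-- because ranks grow by exactly one along saturated chains, which exist by finiteness.
module Submission where

open import Defs
open import Level using (0ℓ)
open import Function using (_∘_; _on_)
open import Data.Nat using (ℕ; zero; suc; _+_; _*_; _∸_; _≤_; _<_; z≤n; s≤s)
open import Data.Nat.Properties
open import Data.Nat.ListAction using (sum)
open import Data.Fin using (Fin)
open import Data.Fin.Properties using () renaming (_≟_ to _≟ᶠ_)
open import Data.Fin.Subset using (Subset; _∈_)
open import Data.Fin.Subset.Properties using (_∈?_)
open import Data.Bool using (if_then_else_)
open import Data.List using (List; []; _∷_; length; filter; map)
open import Data.List using () renaming (allFin to allFinL)
open import Data.List.Properties using (filter-idem; filter-notAll; filter-none; foldr-preservesᵇ)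
open import Data.List.Relation.Unary.All as All using (All; []; _∷_)
open import Data.List.Relation.Unary.All.Properties using (¬Any⇒All¬; concat⁺; map⁺)
open import Data.List.Relation.Unary.Any using (Any; any?; satisfied; toSum)
open import Data.List.Relation.Unary.Any.Properties using (¬Any[])
import Data.List.Membership.Propositional as List
open import Data.List.Membership.Propositional.Properties using (∈-filter⁺; ∈-filter⁻; ∈-allFin)
open import Data.List.Relation.Binary.Sublist.Propositional using (_⊆_; ⊆-refl; _∷ʳ_)
open import Data.List.Relation.Binary.Sublist.Propositional.Properties using (filter⁺; length-mono-≤)
open import Data.Product using (∃; _×_; _,_; proj₁; proj₂)
open import Data.Sum using (_⊎_; inj₁; inj₂)
open import Data.Empty using (⊥-elim)
open import Relation.Nullary using (Dec; yes; no; ¬_; does)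
open import Relation.Nullary.Decidable using (_×-dec_; ¬?)
open import Relation.Unary using (Pred)
import Relation.Unary as U
open import Relation.Binary using (Rel; IsPartialOrder)
open import Relation.Binary.PropositionalEquality using (_≡_; refl; sym; trans; cong; cong₂; subst; module ≡-Reasoning)
open import Induction.WellFounded using (Acc; acc)
open import Data.Nat.Induction using (<-wellFounded)
import Relation.Binary.Construct.On as On

module _ {A : Set} where

  length-filter-mono : ∀ {P Q : Pred A 0ℓ} (P? : U.Decidable P) (Q? : U.Decidable Q) {xs ys} →
                       (∀ {x} → P x → Q x) → xs ⊆ ys →
                       length (filter P? xs) ≤ length (filter Q? ys)
  length-filter-mono P? Q? P⊆Q xs⊆ys = length-mono-≤ (filter⁺ P? Q? (λ { refl → P⊆Q }) xs⊆ys)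

  length-filter-∷ : ∀ {P : Pred A 0ℓ} (P? : U.Decidable P) x xs →
                    length (filter P? xs) ≤ length (filter P? (x ∷ xs))
  length-filter-∷ P? x xs = length-filter-mono P? P? (λ p → p) (x ∷ʳ ⊆-refl)

  length-filter-mono-< : ∀ {P Q : Pred A 0ℓ} (P? : U.Decidable P) (Q? : U.Decidable Q) {xs x} →
                         (∀ {x} → P x → Q x) → x List.∈ xs → Q x → ¬ P x →
                         length (filter P? xs) < length (filter Q? xs)
  length-filter-mono-< P? Q? {xs} P⊆Q x∈xs Qx ¬Px = begin-strict
    length (filter P? xs)                ≡⟨ cong length (filter-idem P? xs) ⟨
    length (filter P? (filter P? xs))    ≤⟨ length-filter-mono P? P? (λ p → p)
                                              (filter⁺ P? Q? (λ { refl → P⊆Q }) (⊆-refl {x = xs})) ⟩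
    length (filter P? (filter Q? xs))    <⟨ filter-notAll P? _ (List.lose (∈-filter⁺ Q? x∈xs Qx) ¬Px) ⟩
    length (filter Q? xs)                ∎
    where open ≤-Reasoning

  length-filter-⊎ : ∀ {P Q R : Pred A 0ℓ} (P? : U.Decidable P) (Q? : U.Decidable Q) (R? : U.Decidable R) →
                    (∀ {x} → P x → Q x ⊎ R x) → ∀ xs →
                    length (filter P? xs) ≤ length (filter Q? xs) + length (filter R? xs)
  length-filter-⊎ P? Q? R? h [] = z≤n
  length-filter-⊎ P? Q? R? h (x ∷ xs) with ih ← length-filter-⊎ P? Q? R? h xs | P? x
  ... | no _ = ≤-trans ih (+-mono-≤ (length-filter-∷ Q? x xs) (length-filter-∷ R? x xs))
  ... | yes p with Q? x | h p
  ...   | yes _ | _      = s≤s (≤-trans ih (+-monoʳ-≤ _ (length-filter-∷ R? x xs)))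
  ...   | no ¬q | inj₁ q = ⊥-elim (¬q q)
  ...   | no _  | inj₂ r with R? x
  ...     | yes _ = ≤-trans (s≤s ih) (≤-reflexive (sym (+-suc _ _)))
  ...     | no ¬r = ⊥-elim (¬r r)

  length-filter-≤-sum : ∀ {B : Set} {P : Pred A 0ℓ} (P? : U.Decidable P)
                        {R : B → Pred A 0ℓ} (R? : ∀ u → U.Decidable (R u)) (us : List B) →
                        (∀ {x} → P x → Any (λ u → R u x) us) → ∀ xs →
                        length (filter P? xs) ≤ sum (map (λ u → length (filter (R? u) xs)) us)
  length-filter-≤-sum P? R? [] cover xs =
    ≤-reflexive (cong length (filter-none P? (All.universal (λ _ → ¬Any[] ∘ cover) xs)))
  length-filter-≤-sum P? R? (u ∷ us) cover xs =
    ≤-trans (length-filter-⊎ P? (R? u) covered? (toSum ∘ cover) xs)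
            (+-monoʳ-≤ _ (length-filter-≤-sum covered? R? us (λ c → c) xs))
    where covered? = λ x → any? (λ u → R? u x) us

  length-filter-≤-witnessed : ∀ {P : Pred A 0ℓ} (P? : U.Decidable P) xs {c} →
                              (∀ {x} → P x → length (filter P? xs) ≤ c) →
                              length (filter P? xs) ≤ c
  length-filter-≤-witnessed P? xs h with any? P? xs
  ... | yes ∃P = h (proj₂ (satisfied ∃P))
  ... | no ∄P  = ≤-trans (≤-reflexive (cong length (filter-none P? (¬Any⇒All¬ xs ∄P)))) z≤n

sum-map-≤ : ∀ {B : Set} (f : B → ℕ) {c} us → All (λ u → f u ≤ c) us → sum (map f us) ≤ length us * c
sum-map-≤ f [] []             = z≤n
sum-map-≤ f (u ∷ us) (p ∷ ps) = +-mono-≤ p (sum-map-≤ f us ps)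

module Ranked (X : RankedSemilattice) where
  open RankedSemilattice X

  open IsPartialOrder isPO public using () renaming (refl to ≼-refl; trans to ≼-trans; antisym to ≼-antisym)

  Chain : Fin N → Fin N → ℕ → Set
  Chain = SatChain _≼_

  chain⇒≼ : ∀ {a b n} → Chain a b n → a ≼ b
  chain⇒≼ (single a)    = ≼-refl
  chain⇒≼ (step a⋖b ch) = ≼-trans (proj₁ a⋖b) (chain⇒≼ ch)

  _++ᶜ_ : ∀ {a b c n k} → Chain a b (suc n) → Chain b c k → Chain a c (n + k)
  single a ++ᶜ ch′ = ch′
  step {n = suc n} a⋖b ch ++ᶜ ch′ = step a⋖b (ch ++ᶜ ch′)

  Interval : Fin N → Fin N → Pred (Fin N) 0ℓ
  Interval a b c = a ≼ c × c ≼ b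

  interval? : ∀ a b → U.Decidable (Interval a b)
  interval? a b c = (a ≼? c) ×-dec (c ≼? b)

  intervalSize : Fin N → Fin N → ℕ
  intervalSize a b = count (Interval a b) (interval? a b)

  intervalSize-< : ∀ {a b a′ b′ e} → a ≼ a′ → b′ ≼ b → a ≼ e → e ≼ b → ¬ Interval a′ b′ e →
                   intervalSize a′ b′ < intervalSize a b
  intervalSize-< {a} {b} {a′} {b′} a≼a′ b′≼b a≼e e≼b e∉ = length-filter-mono-< (interval? a′ b′) (interval? a b)
    (λ (a′≼c , c≼b′) → ≼-trans a≼a′ a′≼c , ≼-trans c≼b′ b′≼b) (∈-allFin _) (a≼e , e≼b) e∉

  _⊏_ : Rel (Fin N × Fin N) 0ℓ
  _⊏_ = _<_ on λ (a , b) → intervalSize a b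

  saturatedChain-acc : ∀ {a b} → Acc _⊏_ (a , b) → a ≼ b → ∃ λ k → Chain a b (suc k)
  saturatedChain-acc {a} {b} (acc smaller) a≼b with a ≟ᶠ b
  ... | yes refl = 0 , single a
  ... | no a≢b with any? (λ c → (a ≼? c) ×-dec (c ≼? b) ×-dec ¬? (c ≟ᶠ a) ×-dec ¬? (c ≟ᶠ b)) (allFinL N)
  ...   | no ∄c = 1 , step (a≼b , a≢b , covers) (single b)
    where
    covers : ∀ c → a ≼ c → c ≼ b → c ≡ a ⊎ c ≡ b
    covers c a≼c c≼b with c ≟ᶠ a | c ≟ᶠ b
    ... | yes c≡a | _       = inj₁ c≡a
    ... | no _    | yes c≡b = inj₂ c≡b
    ... | no c≢a  | no c≢b  = ⊥-elim (∄c (List.lose (∈-allFin c) (a≼c , c≼b , c≢a , c≢b)))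
  ...   | yes ∃c with satisfied ∃c
  ...     | c , a≼c , c≼b , c≢a , c≢b
          with saturatedChain-acc (smaller (intervalSize-< ≼-refl c≼b a≼b ≼-refl
                                     λ (_ , b≼c) → c≢b (≼-antisym c≼b b≼c))) a≼c
             | saturatedChain-acc (smaller (intervalSize-< a≼c ≼-refl ≼-refl a≼b
                                     λ (c≼a , _) → c≢a (≼-antisym c≼a a≼c))) c≼b
  ...       | k₁ , ch₁ | k₂ , ch₂ = k₁ + k₂ , subst (Chain a b) (+-suc k₁ k₂) (ch₁ ++ᶜ ch₂)

  saturatedChain : ∀ {a b} → a ≼ b → ∃ λ k → Chain a b (suc k)
  saturatedChain {a} {b} = saturatedChain-acc (On.wellFounded _ <-wellFounded (a , b))

  rk-via-chain : ∀ {a b k} → Chain a b (suc k) → rk b ≡ rk a + k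
  rk-via-chain {a} {b} {k} ch with saturatedChain (𝟘-least a)
  ... | j , ch₀ = suc-injective (begin
    suc (rk b)       ≡⟨ rk-chain b _ (ch₀ ++ᶜ ch) ⟨
    j + suc k        ≡⟨ +-suc j k ⟩
    suc (j + k)      ≡⟨ cong (λ i → i + k) (rk-chain a _ ch₀) ⟩
    suc (rk a + k)   ∎)
    where open ≡-Reasoning

  chain-prefix : ∀ {a b k} → Chain a b (suc k) → ∀ i → i ≤ k → ∃ λ u → Chain a u (suc i) × u ≼ b
  chain-prefix ch zero _ = _ , single _ , chain⇒≼ ch
  chain-prefix (step {n = suc k} a⋖b ch) (suc i) (s≤s i≤k) with chain-prefix ch i i≤k
  ... | u , ch′ , u≼b = u , step a⋖b ch′ , u≼b

  between-of-rank : ∀ {a b s} → a ≼ b → rk a ≤ s → s ≤ rk b → ∃ λ u → a ≼ u × u ≼ b × rk u ≡ s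
  between-of-rank {a} {b} {s} a≼b a≤s s≤b with saturatedChain a≼b
  ... | k , ch with chain-prefix ch (s ∸ rk a) (m≤n+o⇒m∸n≤o s (rk a) (subst (s ≤_) (rk-via-chain ch) s≤b))
  ... | u , ch′ , u≼b = u , chain⇒≼ ch′ , u≼b , trans (rk-via-chain ch′) (m+[n∸m]≡n a≤s)

  ∧-sandwich : ∀ {x y x′ u} → (x ∧ y) ≼ x′ → x′ ≼ x → (x ∧ y) ≼ u → u ≼ y → x′ ∧ u ≡ x ∧ y
  ∧-sandwich {x} {y} {x′} {u} x∧y≼x′ x′≼x x∧y≼u u≼y = ≼-antisym
    (∧-glb x y (x′ ∧ u) (≼-trans (∧-lb₁ x′ u) x′≼x) (≼-trans (∧-lb₂ x′ u) u≼y))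
    (∧-glb x′ u (x ∧ y) x∧y≼x′ x∧y≼u)

  CommonUpper : Subset N → Fin N → Fin N → Pred (Fin N) 0ℓ
  CommonUpper Y a b z = z ∈ Y × a ≼ z × b ≼ z

  commonUpper? : ∀ Y a b → U.Decidable (CommonUpper Y a b)
  commonUpper? Y a b z = (z ∈? Y) ×-dec (a ≼? z) ×-dec (b ≼? z)

  count-commonUpper≤index : ∀ {T λT Y} → IsDesign X T Y λT → T ≤ m → ∀ a b →
                            rk a + rk b ∸ rk (a ∧ b) ≡ T →
                            count (CommonUpper Y a b) (commonUpper? Y a b) ≤ λT
  count-commonUpper≤index {T} {λT} {Y} (_ , _ , index) T≤m a b rk≡T =
    length-filter-≤-witnessed (commonUpper? Y a b) (allFinL N) λ (_ , a≼z , b≼z) →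
      let v , (a≼v , b≼v , v-least) , rk-v = condIV a b (subst (_≤ m) (sym rk≡T) T≤m) (_ , a≼z , b≼z)
      in begin
        count (CommonUpper Y a b) (commonUpper? Y a b)
          ≤⟨ length-filter-mono (commonUpper? Y a b) (λ z → (z ∈? Y) ×-dec (v ≼? z))
               (λ (z∈Y , a≼z , b≼z) → z∈Y , v-least _ a≼z b≼z) (⊆-refl {x = allFinL N}) ⟩
        count (λ z → z ∈ Y × v ≼ z) (λ z → (z ∈? Y) ×-dec (v ≼? z))
          ≡⟨ index v (trans rk-v rk≡T) ⟩
        λT ∎
    where open ≤-Reasoning

  Layer : ℕ → Fin N → Fin N → Pred (Fin N) 0ℓ
  Layer s a b u = rk u ≡ s × a ≼ u × u ≼ b

  layer? : ∀ s a b → U.Decidable (Layer s a b)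
  layer? s a b u = (rk u ≟ s) ×-dec (a ≼? u) ×-dec (u ≼? b)

  layer : ℕ → Fin N → Fin N → List (Fin N)
  layer s a b = filter (layer? s a b) (allFinL N)

  cnt≤sum-commonUpper : ∀ {s Y} x y → rk (x ∧ y) ≤ s →
                        cnt X s Y x y ≤
                        sum (map (λ u → count (CommonUpper Y x u) (commonUpper? Y x u)) (layer s (x ∧ y) y))
  cnt≤sum-commonUpper {s} {Y} x y x∧y≤s =
    length-filter-≤-sum _ (commonUpper? Y x) (layer s (x ∧ y) y) cover (allFinL N)
    where
    cover : ∀ {z} → z ∈ Y × x ≼ z × s ≤ rk (z ∧ y) → Any (λ u → CommonUpper Y x u z) (layer s (x ∧ y) y)
    cover {z} (z∈Y , x≼z , s≤z∧y)
      with u , x∧y≼u , u≼z∧y , rk-u ←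
           between-of-rank (∧-glb z y (x ∧ y) (≼-trans (∧-lb₁ x y) x≼z) (∧-lb₂ x y)) x∧y≤s s≤z∧y
      = List.lose (∈-filter⁺ (layer? s (x ∧ y) y) (∈-allFin u) (rk-u , x∧y≼u , ≼-trans u≼z∧y (∧-lb₂ z y)))
                  (z∈Y , x≼z , ≼-trans u≼z∧y (∧-lb₁ z y))

  cnt≤μ*index : ∀ {r s T λT Y x y x′} → IsDesign X T Y λT → T ≤ m → y ∈ Y →
                rk (x ∧ y) ≡ r → r ≤ s → (x ∧ y) ≼ x′ → x′ ≼ x → rk x′ + s ∸ r ≡ T →
                cnt X s Y x y ≤ μ r s * λT
  cnt≤μ*index {r} {s} {T} {λT} {Y} {x} {y} {x′} design T≤m y∈Y rk-x∧y r≤s x∧y≼x′ x′≼x rk≡T = begin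
    cnt X s Y x y                        ≤⟨ cnt≤sum-commonUpper x y (subst (_≤ s) (sym rk-x∧y) r≤s) ⟩
    sum (map upperCount (layer s a y))   ≤⟨ sum-map-≤ upperCount (layer s a y) (All.tabulate upperCount≤index) ⟩
    length (layer s a y) * λT            ≡⟨ cong (_* λT) (condI r s y a (proj₁ design y y∈Y) rk-x∧y (∧-lb₂ x y)) ⟩
    μ r s * λT                           ∎
    where
    open ≤-Reasoning
    a = x ∧ y
    upperCount : Fin N → ℕ
    upperCount u = count (CommonUpper Y x u) (commonUpper? Y x u)
    upperCount≤index : ∀ {u} → u List.∈ layer s a y → upperCount u ≤ λT
    upperCount≤index {u} u∈layer with _ , rk-u , a≼u , u≼y ← ∈-filter⁻ (layer? s a y) {xs = allFinL N} u∈layer =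
      ≤-trans (length-filter-mono (commonUpper? Y x u) (commonUpper? Y x′ u)
                 (λ (z∈Y , x≼z , u≼z) → z∈Y , ≼-trans x′≼x x≼z , u≼z) (⊆-refl {x = allFinL N}))
              (count-commonUpper≤index design T≤m x′ u rank-join)
      where
      rank-join : rk x′ + rk u ∸ rk (x′ ∧ u) ≡ T
      rank-join = trans (cong (λ w → rk x′ + rk u ∸ rk w) (∧-sandwich x∧y≼x′ x′≼x a≼u u≼y))
                        (trans (cong₂ (λ p q → rk x′ + p ∸ q) rk-u rk-x∧y) rk≡T)

  d≤ : ∀ {r s Y B} → (∀ x y → rk x ≡ s → y ∈ Y → rk (x ∧ y) ≡ r → cnt X s Y x y ≤ B) → d X r s Y ≤ B
  d≤ {r} {s} {Y} {B} bound = foldr-preservesᵇ ⊔-lub z≤n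
    (concat⁺ (map⁺ (All.universal (λ x → concat⁺ (map⁺ (All.universal (λ y →
      candidate ((rk x ≟ s) ×-dec (y ∈? Y) ×-dec (rk (x ∧ y) ≟ r))
                (λ (rk-x , y∈Y , rk-x∧y) → bound x y rk-x y∈Y rk-x∧y)) (allFinL N)))) (allFinL N))))
    where
    candidate : ∀ {P : Set} {c} (P? : Dec P) → (P → c ≤ B) → All (_≤ B) (if does P? then c ∷ [] else [])
    candidate (yes p) c≤B = c≤B p ∷ []
    candidate (no _)  _   = []

r+[t∸s]≤s : ∀ r {s t} → s ≤ t → r + t ≤ 2 * s → r + (t ∸ s) ≤ s
r+[t∸s]≤s r {s} {t} s≤t r+t≤2s = subst (_≤ s) (+-∸-assoc r s≤t)
  (m≤n+o⇒m∸n≤o (r + t) s (subst (r + t ≤_) (cong (s +_) (+-identityʳ s)) r+t≤2s))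

r+[t∸s]+s∸r≡t : ∀ r {s t} → s ≤ t → r + (t ∸ s) + s ∸ r ≡ t
r+[t∸s]+s∸r≡t r {s} {t} s≤t =
  trans (cong (_∸ r) (+-assoc r (t ∸ s) s)) (trans (m+n∸m≡n r (t ∸ s + s)) (m∸n+n≡m s≤t))

mainTheorem3 : (X : RankedSemilattice) → (r s t : ℕ) →
    r ≤ s → s < t → t ≤ RankedSemilattice.m X → 0 < s →
    (Y : Subset (RankedSemilattice.N X)) → (λt : ℕ) → IsDesign X t Y λt →
    (2 * s ≤ r + t → r < s →
    ∀ (λ' : ℕ) → IsDesign X (2 * s ∸ r) Y λ' →
    d X r s Y ≤ RankedSemilattice.μ X r s * λ')
    × (r + t ≤ 2 * s → d X r s Y ≤ RankedSemilattice.μ X r s * λt)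
mainTheorem3 X r s t r≤s s<t t≤m _ Y λt design = part₁ , part₂
  where
  open RankedSemilattice X
  open Ranked X

  part₁ : 2 * s ≤ r + t → r < s → ∀ λ′ → IsDesign X (2 * s ∸ r) Y λ′ → d X r s Y ≤ μ r s * λ′
  part₁ 2s≤r+t _ λ′ design′ = d≤ λ x y rk-x y∈Y rk-x∧y →
    cnt≤μ*index design′ (≤-trans (m≤n+o⇒m∸n≤o (2 * s) r 2s≤r+t) t≤m) y∈Y rk-x∧y r≤s (∧-lb₁ x y) ≼-refl
      (trans (cong (λ w → w + s ∸ r) rk-x) (cong (λ w → s + w ∸ r) (sym (+-identityʳ s))))

  part₂ : r + t ≤ 2 * s → d X r s Y ≤ μ r s * λt
  part₂ r+t≤2s = d≤ λ x y rk-x y∈Y rk-x∧y →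
    let x′ , x∧y≼x′ , x′≼x , rk-x′ = between-of-rank (∧-lb₁ x y) (subst (_≤ s′) (sym rk-x∧y) (m≤m+n r _))
                                                       (subst (s′ ≤_) (sym rk-x) (r+[t∸s]≤s r (<⇒≤ s<t) r+t≤2s))
    in cnt≤μ*index design t≤m y∈Y rk-x∧y r≤s x∧y≼x′ x′≼x (trans (cong (λ w → w + s ∸ r) rk-x′) (r+[t∸s]+s∸r≡t r (<⇒≤ s<t)))
    where s′ = r + (t ∸ s)
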